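{- Let $G=(V,E)$ be a connected graph with $n\ge 2$ vertices, $b$ an integer with $1\le b<n$, and $\mathcal{D}$ a fixed rooted spanning tree of $G$. For every $b$-ordering $\pi$ of $G$ there exists a segment assignment (with respect to $\mathcal{D}$) consistent with $\pi$.
   Context: An ordering is a bijection $\pi:V\to\{1,\dots,n\}$; it is a $b$-ordering if $|\pi(u)-\pi(v)|\le b$ for every edge $uv\in E$. For integers $i<j$, the segment $\Theta_{(i,j)}$ is the set $\{i(b+1)+1, i(b+1)+2,\dots, j(b+1)\}\cap\{1,\dots,n\}$, considered only when it is nonempty. In the rooted tree $\mathcal{D}$, a leaf is a non-root vertex with no children, all other vertices (including the root) are inner vertices. A segment assignment is a function $\phi$ assigning a segment to every vertex such that: (1) every leaf of $\mathcal{D}$ is assigned a segment of the form $\Theta_{(i,i+4)}$; (2) every inner vertex is assigned a segment of the form $\Theta_{(i,i+2)}$; (3) for every edge of $\mathcal{D}$ where $u$ is the parent of an inner vertex $v$, with $\phi(u)=\Theta_{(i,i+2)}$ and $\phi(v)=\Theta_{(j,j+2)}$, we have $|i-j|=1$; (4) for every leaf $v$ with parent $u$, if $\phi(u)=\Theta_{(i,i+2)}$ then $\phi(v)=\Theta_{(i-1,i+3)}$. A segment assignment $\phi$ is consistent with an ordering $\pi$ if $\pi(v)\in\phi(v)$ for every vertex $v$. -}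

module Defs where

open import Data.Nat as ℕ using (ℕ; zero; suc)
open import Data.Fin using (Fin; toℕ)
open import Data.Integer as ℤ using (ℤ; +_; _+_; _*_; _-_; ∣_∣)
open import Data.Product using (Σ; ∃; _×_; _,_)
open import Function.Bundles using (_⤖_; Bijection)
open import Relation.Binary.PropositionalEquality using (_≡_; _≢_)
open import Relation.Nullary using (¬_)

iterate : ∀ {A : Set} → (A → A) → ℕ → A → A
iterate f zero x = x
iterate f (suc k) x = f (iterate f k x)

record Graph (n : ℕ) : Set₁ where
  field
    Adj     : Fin n → Fin n → Set
    sym     : ∀ {u v} → Adj u v → Adj v u
    irrefl  : ∀ {v} → ¬ Adj v v

data Reach {n : ℕ} (G : Graph n) : Fin n → Fin n → Set where
  here : ∀ {v} → Reach G v v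
  step : ∀ {u w v} → Graph.Adj G u w → Reach G w v → Reach G u v

Connected : ∀ {n} → Graph n → Set
Connected {n} G = ∀ (u v : Fin n) → Reach G u v

-- A rooted spanning tree D of G, given by a root and a parent map
-- (parent root = root by convention); every non-root vertex is joined
-- to its parent by an edge of G, and iterating parent reaches the root
-- (acyclicity).
record RootedSpanningTree {n : ℕ} (G : Graph n) : Set where
  field
    root        : Fin n
    parent      : Fin n → Fin n
    parent-root : parent root ≡ root
    tree-edge   : ∀ v → v ≢ root → Graph.Adj G (parent v) v
    reaches     : ∀ v → ∃ λ k → iterate parent k v ≡ root

module _ {n : ℕ} {G : Graph n} (D : RootedSpanningTree G) where
  open RootedSpanningTree D

  Child : Fin n → Fin n → Set
  Child w v = w ≢ root × parent w ≡ v

  Leaf : Fin n → Set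
  Leaf v = v ≢ root × (∀ w → ¬ Child w v)

  -- inner vertex: every vertex that is not a leaf (including the root)
  Inner : Fin n → Set
  Inner v = ¬ Leaf v

-- An ordering: a bijection V → {1,…,n}; position of v is 1 + index.
Ordering : ℕ → Set
Ordering n = Fin n ⤖ Fin n

pos : ∀ {n} → Ordering n → Fin n → ℕ
pos π v = suc (toℕ (Bijection.to π v))

IsBOrdering : ∀ {n} → Graph n → ℕ → Ordering n → Set
IsBOrdering {n} G b π =
  ∀ (u v : Fin n) → Graph.Adj G u v → ∣ (+ pos π u) - (+ pos π v) ∣ ℕ.≤ b

-- p ∈ Θ_(i,j) = {i(b+1)+1, …, j(b+1)} ∩ {1,…,n}  (i, j integers)
InSegment : (n b : ℕ) → ℤ → ℤ → ℕ → Set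
InSegment n b i j p =
  ((i * (+ suc b)) + (+ 1) ℤ.≤ (+ p)) × ((+ p) ℤ.≤ j * (+ suc b)) × (1 ℕ.≤ p) × (p ℕ.≤ n)

-- A segment assignment w.r.t. D, represented by the left index ι v of
-- the segment assigned to v: Θ_(ι v, ι v + 4) for leaves and
-- Θ_(ι v, ι v + 2) for inner vertices (conditions (1),(2)), together with
-- conditions (3) and (4).
record SegmentAssignment {n : ℕ} {G : Graph n} (D : RootedSpanningTree G) : Set where
  open RootedSpanningTree D
  field
    ι        : Fin n → ℤ
    inner-edge : ∀ v → v ≢ root → Inner D v → ∣ ι (parent v) - ι v ∣ ≡ 1
    leaf-edge  : ∀ v → Leaf D v → ι v ≡ ι (parent v) - (+ 1)

Consistent : ∀ {n} {G : Graph n} (b : ℕ) (D : RootedSpanningTree G) →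
  SegmentAssignment D → Ordering n → Set
Consistent {n} b D φ π =
  ∀ v → (Leaf D v → InSegment n b (ι v) (ι v + (+ 4)) (pos π v))
      × (Inner D v → InSegment n b (ι v) (ι v + (+ 2)) (pos π v))
  where open SegmentAssignment φ

-- Cut the positions into blocks Θ_(q, q + 1) of length b + 1; the two ends of an edge lie in
-- blocks at distance at most one. An inner vertex v in block q at depth d gets the segment
-- starting at q or q - 1, whichever has the parity of d: it covers the block of v, and the
-- parities make the starting indices of parent and child differ by exactly one. A leaf gets the
-- index of its parent minus one, and its wide segment covers the blocks next to its parent's.
module Submission where

open import Defs
open import Data.Nat using (ℕ; _≤_; _<_)
open import Data.Product using (Σ; ∃; _×_; _,_; proj₁; proj₂)
open import Data.Bool using (Bool; true; false; not)
open import Data.Bool.Properties using (not-involutive)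
open import Data.Empty using (⊥-elim)
open import Data.Fin using (Fin; toℕ)
open import Data.Fin.Properties using (_≟_; all?; toℕ<n)
open import Data.Integer as ℤ using (ℤ; +_; ∣_∣; +≤+)
import Data.Integer.Properties as ℤP
open import Data.Integer.Tactic.RingSolver using (solve-∀)
open import Data.Nat as ℕ using (zero; suc; z≤n; s≤s; _/_; _∸_)
import Data.Nat.Properties as ℕP
open import Data.Nat.DivMod using (m≡m%n+[m/n]*n; m%n<n; m/n*n≤m; /-monoˡ-≤; m/n≡1+[m∸n]/n)
open import Data.Sum using (_⊎_; inj₁; inj₂; [_,_]′)
open import Function.Bundles using (Bijection)
open import Relation.Binary.Definitions using (DecidableEquality; tri<; tri≈; tri>)
open import Relation.Binary.PropositionalEquality
open import Relation.Nullary using (Dec; yes; no; ¬_)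
open import Relation.Nullary.Decidable using (_×-dec_; ¬?)

module _ {P : ℕ → Set} (P? : ∀ k → Dec (P k)) where

  private
    leastBelow : ∀ k → (∃ λ m → P m × (∀ j → P j → m ≤ j)) ⊎ (∀ j → j < k → ¬ P j)
    leastBelow zero = inj₂ (λ _ ())
    leastBelow (suc k) with leastBelow k
    ... | inj₁ least = inj₁ least
    ... | inj₂ none with P? k
    ...   | yes pk = inj₁ (k , pk , λ j pj → ℕP.≮⇒≥ (λ j<k → none j j<k pj))
    ...   | no ¬pk = inj₂ λ j j<1+k →
            [ none j , (λ { refl → ¬pk }) ]′ (ℕP.m<1+n⇒m<n∨m≡n j<1+k)

  leastWitness : ∃ P → ∃ λ m → P m × (∀ j → P j → m ≤ j)
  leastWitness (k , pk) with leastBelow (suc k)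
  ... | inj₁ least = least
  ... | inj₂ none = ⊥-elim (none k (ℕP.n<1+n k) pk)

iterate-suc : ∀ {A : Set} (f : A → A) k x → iterate f (suc k) x ≡ iterate f k (f x)
iterate-suc f zero x = refl
iterate-suc f (suc k) x = cong f (iterate-suc f k x)

module Depth {A : Set} (_≟ᴬ_ : DecidableEquality A) (f : A → A) (r : A)
             (reaches : ∀ a → ∃ λ k → iterate f k a ≡ r) where

  private
    least : ∀ a → ∃ λ m → iterate f m a ≡ r × (∀ j → iterate f j a ≡ r → m ≤ j)
    least a = leastWitness (λ k → iterate f k a ≟ᴬ r) (reaches a)

  depth : A → ℕ
  depth a = proj₁ (least a)

  iterate-depth : ∀ a → iterate f (depth a) a ≡ r
  iterate-depth a = proj₁ (proj₂ (least a))

  depth-minimal : ∀ a j → iterate f j a ≡ r → depth a ≤ j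
  depth-minimal a = proj₂ (proj₂ (least a))

  depth-step : ∀ a → a ≢ r → depth a ≡ suc (depth (f a))
  depth-step a a≢r with depth a | iterate-depth a | depth-minimal a
  ... | zero  | a≡r  | _       = ⊥-elim (a≢r a≡r)
  ... | suc k | reach | minimal = cong suc (ℕP.≤-antisym k≤ ≤k)
    where
    k≤ : k ≤ depth (f a)
    k≤ = ℕ.s≤s⁻¹ (minimal (suc (depth (f a))) (trans (iterate-suc f (depth (f a)) a) (iterate-depth (f a))))
    ≤k : depth (f a) ≤ k
    ≤k = depth-minimal (f a) k (trans (sym (iterate-suc f k a)) reach)

odd : ℕ → Bool
odd zero = false
odd (suc n) = not (odd n)

odd-+-suc : ∀ m n → odd (m ℕ.+ suc n) ≡ not (odd (m ℕ.+ n))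
odd-+-suc m n rewrite ℕP.+-suc m n = refl

bit : Bool → ℕ
bit false = 0
bit true = 1

innerIndex : ℕ → ℕ → ℤ
innerIndex q d = + q ℤ.- + bit (odd (q ℕ.+ d))

[1+i]-e≡[i-e]+1 : ∀ (i e : ℤ) → (+ 1 ℤ.+ i) ℤ.- e ≡ (i ℤ.- e) ℤ.+ + 1
[1+i]-e≡[i-e]+1 = solve-∀

innerIndex-suc-suc : ∀ q d → innerIndex (suc q) (suc d) ≡ innerIndex q d ℤ.+ + 1
innerIndex-suc-suc q d = begin
  + suc q ℤ.- + bit (odd (suc q ℕ.+ suc d))    ≡⟨ cong (λ x → + suc q ℤ.- + bit x) odd-equal ⟩
  + suc q ℤ.- + bit (odd (q ℕ.+ d))            ≡⟨ [1+i]-e≡[i-e]+1 (+ q) (+ bit (odd (q ℕ.+ d))) ⟩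
  innerIndex q d ℤ.+ + 1                        ∎
  where
  open ≡-Reasoning
  odd-equal : odd (suc q ℕ.+ suc d) ≡ odd (q ℕ.+ d)
  odd-equal = trans (cong not (odd-+-suc q d)) (not-involutive _)

innerIndex-suc-swap : ∀ q d → innerIndex (suc q) d ≡ innerIndex q (suc d) ℤ.+ + 1
innerIndex-suc-swap q d = begin
  + suc q ℤ.- + bit (odd (suc q ℕ.+ d))        ≡⟨ cong (λ x → + suc q ℤ.- + bit x) (sym (odd-+-suc q d)) ⟩
  + suc q ℤ.- + bit (odd (q ℕ.+ suc d))        ≡⟨ [1+i]-e≡[i-e]+1 (+ q) (+ bit (odd (q ℕ.+ suc d))) ⟩
  innerIndex q (suc d) ℤ.+ + 1                  ∎
  where open ≡-Reasoning

innerIndex-flip : ∀ q d → ∣ innerIndex q d ℤ.- innerIndex q (suc d) ∣ ≡ 1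
innerIndex-flip q d rewrite odd-+-suc q d with odd (q ℕ.+ d)
... | false = cong ∣_∣ ([i-0]-[i-1]≡1 (+ q))
  where
  [i-0]-[i-1]≡1 : ∀ i → (i ℤ.- + 0) ℤ.- (i ℤ.- + 1) ≡ + 1
  [i-0]-[i-1]≡1 = solve-∀
... | true = cong ∣_∣ ([i-1]-[i-0]≡-1 (+ q))
  where
  [i-1]-[i-0]≡-1 : ∀ i → (i ℤ.- + 1) ℤ.- (i ℤ.- + 0) ≡ ℤ.- + 1
  [i-1]-[i-0]≡-1 = solve-∀

innerIndex-adjacent : ∀ {qu qv} d → qu ≤ suc qv → qv ≤ suc qu →
  ∣ innerIndex qu d ℤ.- innerIndex qv (suc d) ∣ ≡ 1
innerIndex-adjacent {qu} {qv} d qu≤ qv≤ with ℕP.<-cmp qu qv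
... | tri< qu<qv _ _ rewrite ℕP.≤-antisym qv≤ qu<qv | innerIndex-suc-suc qu d =
  cong ∣_∣ (i-[i+1]≡-1 (innerIndex qu d))
  where
  i-[i+1]≡-1 : ∀ i → i ℤ.- (i ℤ.+ + 1) ≡ ℤ.- + 1
  i-[i+1]≡-1 = solve-∀
... | tri≈ _ refl _ = innerIndex-flip qu d
... | tri> _ _ qv<qu rewrite ℕP.≤-antisym qu≤ qv<qu | innerIndex-suc-swap qv d =
  cong ∣_∣ ([i+1]-i≡1 (innerIndex qv (suc d)))
  where
  [i+1]-i≡1 : ∀ i → (i ℤ.+ + 1) ℤ.- i ≡ + 1
  [i+1]-i≡1 = solve-∀

Within : ℤ → ℕ → Set
Within ι q = ι ℤ.≤ + q × + q ℤ.≤ ι ℤ.+ + 1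

innerIndex-within : ∀ q d → Within (innerIndex q d) q
innerIndex-within q d = ℤP.i-j≤i (+ q) (+ bit (odd (q ℕ.+ d))) , ≤-bit (odd (q ℕ.+ d))
  where
  ≤-bit : ∀ x → + q ℤ.≤ (+ q ℤ.- + bit x) ℤ.+ + 1
  ≤-bit false = ℤP.≤-trans (ℤP.i≤i+j (+ q) (+ 1)) (ℤP.≤-reflexive (i+1≡[i-0]+1 (+ q)))
    where
    i+1≡[i-0]+1 : ∀ i → i ℤ.+ + 1 ≡ (i ℤ.- + 0) ℤ.+ + 1
    i+1≡[i-0]+1 = solve-∀
  ≤-bit true = ℤP.≤-reflexive (i≡[i-1]+1 (+ q))
    where
    i≡[i-1]+1 : ∀ i → i ≡ (i ℤ.- + 1) ℤ.+ + 1
    i≡[i-1]+1 = solve-∀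

within-upper : ∀ {ι q} → Within ι q → + suc q ℤ.≤ ι ℤ.+ + 2
within-upper {ι} {q} (_ , q≤) = begin
  + 1 ℤ.+ + q          ≤⟨ ℤP.+-monoʳ-≤ (+ 1) q≤ ⟩
  + 1 ℤ.+ (ι ℤ.+ + 1)  ≡⟨ regroup ι ⟩
  ι ℤ.+ + 2            ∎
  where
  open ℤP.≤-Reasoning
  regroup : ∀ i → + 1 ℤ.+ (i ℤ.+ + 1) ≡ i ℤ.+ + 2
  regroup = solve-∀

within-neighbour-lower : ∀ {ι qu qv} → Within ι qu → qu ≤ suc qv → ι ℤ.- + 1 ℤ.≤ + qv
within-neighbour-lower {ι} {qu} {qv} (ι≤ , _) qu≤ = begin
  ι ℤ.- + 1                ≤⟨ ℤP.+-monoˡ-≤ (ℤ.- + 1) (ℤP.≤-trans ι≤ (+≤+ qu≤)) ⟩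
  (+ 1 ℤ.+ + qv) ℤ.- + 1   ≡⟨ cancel (+ qv) ⟩
  + qv                     ∎
  where
  open ℤP.≤-Reasoning
  cancel : ∀ i → (+ 1 ℤ.+ i) ℤ.- + 1 ≡ i
  cancel = solve-∀

within-neighbour-upper : ∀ {ι qu qv} → Within ι qu → qv ≤ suc qu → + suc qv ℤ.≤ (ι ℤ.- + 1) ℤ.+ + 4
within-neighbour-upper {ι} {qu} {qv} (_ , qu≤) qv≤ = begin
  + suc qv               ≤⟨ +≤+ (s≤s qv≤) ⟩
  + 2 ℤ.+ + qu           ≤⟨ ℤP.+-monoʳ-≤ (+ 2) qu≤ ⟩
  + 2 ℤ.+ (ι ℤ.+ + 1)    ≡⟨ regroup ι ⟩
  (ι ℤ.- + 1) ℤ.+ + 4    ∎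
  where
  open ℤP.≤-Reasoning
  regroup : ∀ i → + 2 ℤ.+ (i ℤ.+ + 1) ≡ (i ℤ.- + 1) ℤ.+ + 4
  regroup = solve-∀

∣+m-+n∣≤o⇒m≤n+o : ∀ m n {o} → ∣ + m ℤ.- + n ∣ ≤ o → m ≤ n ℕ.+ o
∣+m-+n∣≤o⇒m≤n+o m n {o} h with ℕP.≤-total m n
... | inj₁ m≤n = ℕP.≤-trans m≤n (ℕP.m≤m+n n o)
... | inj₂ n≤m = ℕP.≤-trans (ℕP.m≤n+m∸n m n) (ℕP.+-monoʳ-≤ n (subst (_≤ o) dist h))
  where
  dist : ∣ + m ℤ.- + n ∣ ≡ m ∸ n
  dist = trans (cong ∣_∣ (ℤP.m-n≡m⊖n m n)) (trans (ℤP.∣m⊖n∣≡∣n⊖m∣ m n) (ℤP.∣⊖∣-≤ n≤m))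

m≤n+d⇒m/d≤1+n/d : ∀ m n d .{{_ : ℕ.NonZero d}} → m ≤ n ℕ.+ d → m / d ≤ suc (n / d)
m≤n+d⇒m/d≤1+n/d m n d m≤ = begin
  m / d                    ≤⟨ /-monoˡ-≤ d m≤ ⟩
  (n ℕ.+ d) / d            ≡⟨ m/n≡1+[m∸n]/n (ℕP.m≤n+m d n) ⟩
  suc ((n ℕ.+ d ∸ d) / d)  ≡⟨ cong (λ k → suc (k / d)) (ℕP.m+n∸n≡m n d) ⟩
  suc (n / d)              ∎
  where open ℕP.≤-Reasoning

-- The hypotheses say Θ_(q, q + 1) ⊆ Θ_(i, j), where Θ_(q, q + 1) ∋ x + 1 for q = x / (b + 1).
block-in-segment : ∀ {n b x} (i j : ℤ) → x < n →
  i ℤ.≤ + (x / suc b) → + suc (x / suc b) ℤ.≤ j → InSegment n b i j (suc x)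
block-in-segment {n} {b} {x} i j x<n i≤q 1+q≤j = lower , upper , s≤s z≤n , x<n
  where
  s = suc b
  q = x / s
  lower : i ℤ.* + s ℤ.+ + 1 ℤ.≤ + suc x
  lower = begin
    i ℤ.* + s ℤ.+ + 1     ≤⟨ ℤP.+-monoˡ-≤ (+ 1) (ℤP.*-monoʳ-≤-nonNeg (+ s) i≤q) ⟩
    + q ℤ.* + s ℤ.+ + 1   ≡⟨ cong (ℤ._+ + 1) (sym (ℤP.pos-* q s)) ⟩
    + (q ℕ.* s ℕ.+ 1)     ≤⟨ +≤+ (ℕP.+-monoˡ-≤ 1 (m/n*n≤m x s)) ⟩
    + (x ℕ.+ 1)           ≡⟨ cong +_ (ℕP.+-comm x 1) ⟩
    + suc x               ∎
    where open ℤP.≤-Reasoning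
  upper : + suc x ℤ.≤ j ℤ.* + s
  upper = begin
    + suc x               ≤⟨ +≤+ (subst (λ k → suc k ≤ s ℕ.+ q ℕ.* s) (sym (m≡m%n+[m/n]*n x s))
                                       (ℕP.+-monoˡ-≤ (q ℕ.* s) (m%n<n x s))) ⟩
    + (suc q ℕ.* s)       ≡⟨ ℤP.pos-* (suc q) s ⟩
    + suc q ℤ.* + s       ≤⟨ ℤP.*-monoʳ-≤-nonNeg (+ s) 1+q≤j ⟩
    j ℤ.* + s             ∎
    where open ℤP.≤-Reasoning

module Construction {n} {G : Graph n} (b : ℕ) (D : RootedSpanningTree G)
                    (π : Ordering n) (b-ordering : IsBOrdering G b π) where
  open RootedSpanningTree D
  open Depth _≟_ parent root reaches

  index : Fin n → ℕ
  index v = toℕ (Bijection.to π v)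

  block : Fin n → ℕ
  block v = index v / suc b

  block-adjacent : ∀ {u v} → Graph.Adj G u v → block u ≤ suc (block v)
  block-adjacent {u} {v} uv = m≤n+d⇒m/d≤1+n/d (index u) (index v) (suc b)
    (ℕP.≤-trans (ℕ.s≤s⁻¹ (∣+m-+n∣≤o⇒m≤n+o _ _ (b-ordering u v uv))) (ℕP.+-monoʳ-≤ (index v) (ℕP.n≤1+n b)))

  Child? : ∀ w v → Dec (Child D w v)
  Child? w v = ¬? (w ≟ root) ×-dec (parent w ≟ v)

  Leaf? : ∀ v → Dec (Leaf D v)
  Leaf? v = ¬? (v ≟ root) ×-dec all? (λ w → ¬? (Child? w v))

  parent-inner : ∀ v → v ≢ root → Inner D (parent v)
  parent-inner v v≢root (_ , childless) = childless v (v≢root , refl)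

  innerIndexOf : Fin n → ℤ
  innerIndexOf v = innerIndex (block v) (depth v)

  ι : Fin n → ℤ
  ι v with Leaf? v
  ... | yes _ = innerIndexOf (parent v) ℤ.- + 1
  ... | no _ = innerIndexOf v

  ι-leaf : ∀ v → Leaf D v → ι v ≡ innerIndexOf (parent v) ℤ.- + 1
  ι-leaf v leaf with Leaf? v
  ... | yes _ = refl
  ... | no ¬leaf = ⊥-elim (¬leaf leaf)

  ι-inner : ∀ v → Inner D v → ι v ≡ innerIndexOf v
  ι-inner v inner with Leaf? v
  ... | yes leaf = ⊥-elim (inner leaf)
  ... | no _ = refl

  inner-edge : ∀ v → v ≢ root → Inner D v → ∣ ι (parent v) ℤ.- ι v ∣ ≡ 1
  inner-edge v v≢root inner
    rewrite ι-inner (parent v) (parent-inner v v≢root) | ι-inner v inner | depth-step v v≢root =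
    innerIndex-adjacent (depth (parent v))
      (block-adjacent (tree-edge v v≢root))
      (block-adjacent (Graph.sym G (tree-edge v v≢root)))

  leaf-edge : ∀ v → Leaf D v → ι v ≡ ι (parent v) ℤ.- + 1
  leaf-edge v leaf = trans (ι-leaf v leaf)
    (cong (ℤ._- + 1) (sym (ι-inner (parent v) (parent-inner v (proj₁ leaf)))))

  assignment : SegmentAssignment D
  assignment = record { ι = ι ; inner-edge = inner-edge ; leaf-edge = leaf-edge }

  inner-in-segment : ∀ v → Inner D v → InSegment n b (ι v) (ι v ℤ.+ + 2) (pos π v)
  inner-in-segment v inner rewrite ι-inner v inner =
    block-in-segment _ _ (toℕ<n (Bijection.to π v)) (proj₁ within) (within-upper within)
    where within = innerIndex-within (block v) (depth v)

  leaf-in-segment : ∀ v → Leaf D v → InSegment n b (ι v) (ι v ℤ.+ + 4) (pos π v)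
  leaf-in-segment v leaf@(v≢root , _) rewrite ι-leaf v leaf =
    block-in-segment _ _ (toℕ<n (Bijection.to π v))
      (within-neighbour-lower within (block-adjacent (tree-edge v v≢root)))
      (within-neighbour-upper within (block-adjacent (Graph.sym G (tree-edge v v≢root))))
    where within = innerIndex-within (block (parent v)) (depth (parent v))

  consistent : Consistent b D assignment π
  consistent v = leaf-in-segment v , inner-in-segment v

lemma2 : (n : ℕ) → 2 ≤ n → (G : Graph n) → Connected G →
    (b : ℕ) → 1 ≤ b → b < n → (D : RootedSpanningTree G) →
    (π : Ordering n) → IsBOrdering G b π →
    Σ (SegmentAssignment D) (λ φ → Consistent b D φ π)
lemma2 n _ G _ b _ _ D π b-ordering = assignment , consistent
  where open Construction b D π b-ordering
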